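{- In the combinatorial Marker-Cutter game, let $(D_k,\chi_k,g_k)$ be a game state and let $C$ be a directed cycle of $D_k$ carrying isolated labels $a$ and $b$. If Marker chooses vertices $v,w\in V(C)$ separating $a$ and $b$, then moves (b) and (c) are not legal for restricted Cutter; in particular restricted Cutter either has to make a move of type (a) or has no legal move.
   Context: A set of boundary cycles is a pair $(D,\chi)$: $D$ a finite directed graph each of whose components is a directed cycle (loops allowed, no isolated vertices), $\chi:E(D)\to L$ an edge labelling; proper if each label is used on at most two edges. A label is isolated if it appears on only one component of $D$. A game state is $(D,\chi,g)$ with $(D,\chi)$ proper, $g\in\mathbb N_0$; its value is the number of labels used. Game moves: at turn $k$ with state $(D_k,\chi_k,g_k)$, Marker chooses $v,w$ (not necessarily distinct) from $V(D_k)$ or dummy vertices. Splitting a vertex $u$ replaces it by a source $u_1$ (incident to the out-edge) and a sink $u_2$ (incident to the in-edge). If $v,w$ lie on the same cycle $C$: splitting turns $C$ into a directed path $P$ from $v_1$ to $w_2$ and a directed path $P'$ from $w_1$ to $v_2$; add new edges $f=\overrightarrow{w_2v_1}$, $f'=\overrightarrow{v_2w_1}$; $\hat C_1=P\cup\{f\}$, $\hat C_2=P'\cup\{f'\}$. Cutter chooses (a) $D_{k+1}=\bar D\cup\hat C_1\cup\hat C_2$, $g_{k+1}=g_k-1$ (only if $g_k\ge1$); (b) $D_{k+1}=\bar D\cup\hat C_1$, $g_{k+1}=\bar g$; or (c) $D_{k+1}=\bar D\cup\hat C_2$, $g_{k+1}=\bar g$; with $\bar D$ a union of components of $D_k\setminus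 C$, $0\le\bar g\le g_k$. If $v,w$ lie on different cycles $C,C'$, the only move (d) replaces $C\cup C'$ by the cycle $P\cup P'\cup\{\overrightarrow{w_2v_1},\overrightarrow{v_2w_1}\}$, where $P$ is the path from $v_1$ to $v_2$ obtained from $C$ and $P'$ from $w_1$ to $w_2$ obtained from $C'$, with $g$ unchanged. New edges get one common new label; old labels are kept. The vertices $v,w\in V(C)$ separate labels $a$ and $b$ if $a$ occurs only on one of the two segments of $C$ between $v$ and $w$ and $b$ occurs only on the other. A contraction contracts one edge (deleting resulting isolated vertices). $(D',\chi',g')$ is a reduction of $(D,\chi,g)$ if $g'\le g$, $D'$ is obtained from $D$ by contractions and $\chi'=\chi$ on $E(D')$. Game states are equivalent if they are isomorphic as labelled digraphs up to a bijective relabelling and have equal counters. Restricted Cutter may never make a move producing a game state equivalent to a reduction of an earlier game state (including the current one), and in moves (a), (b), (c) must take $\bar D=D_k\setminus C$ and $\bar g=g_k$. -}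

module Defs where

open import Data.Nat using (ℕ; zero; suc; _≤_; _∸_)
open import Data.Fin using (Fin; zero; suc; _≟_)
open import Data.Product using (Σ; ∃; _×_; _,_)
open import Data.Sum using (_⊎_)
open import Data.Unit using (⊤)
open import Data.Empty using (⊥)
open import Data.List using (List)
open import Data.List.Membership.Propositional using (_∈_)
open import Relation.Nullary using (¬_; yes; no)
open import Relation.Binary.PropositionalEquality using (_≡_; _≢_)
open import Relation.Binary.Construct.Closure.ReflexiveTransitive using (Star)

-- Encoding of a finite digraph every component of which is a directed
-- cycle (loops allowed, no isolated vertices): every vertex has exactly
-- one out-edge and one in-edge.  Vertices are Fin n; the edge leaving
-- vertex x goes to σ x, and we identify this edge with its tail x.
-- Hence χ : Fin n → ℕ is the edge labelling (labels L = ℕ).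

record LDigraph : Set where
  field
    n : ℕ
    σ : Fin n → Fin n
    χ : Fin n → ℕ
open LDigraph public

record CycleDigraph (G : LDigraph) : Set where
  field
    σ⁻¹    : Fin (n G) → Fin (n G)
    σσ⁻¹   : ∀ x → σ G (σ⁻¹ x) ≡ x
    σ⁻¹σ   : ∀ x → σ⁻¹ (σ G x) ≡ x

Proper : LDigraph → Set
Proper G = ∀ x y z → x ≢ y → y ≢ z → x ≢ z →
           χ G x ≡ χ G y → χ G y ≡ χ G z → ⊥

record GameState : Set where
  field
    graph  : LDigraph
    cyc    : CycleDigraph graph
    proper : Proper graph
    g      : ℕ
open GameState public

iter : ∀ {m} → (Fin m → Fin m) → ℕ → Fin m → Fin m
iter f zero    x = x
iter f (suc k) x = f (iter f k x)

SameCycle : (G : LDigraph) → Fin (n G) → Fin (n G) → Set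
SameCycle G x y = ∃ λ k → iter (σ G) k x ≡ y

-- edge e lies on the segment of the cycle from v to w
-- (the edges with tails v, σ v, …, up to but excluding the edge out of w)
Seg : (G : LDigraph) → Fin (n G) → Fin (n G) → Fin (n G) → Set
Seg G v w e = ∃ λ k → iter (σ G) k v ≡ e × (∀ j → j ≤ k → iter (σ G) j v ≢ w)

Isolated : LDigraph → ℕ → Set
Isolated G a = (∃ λ e → χ G e ≡ a) ×
               (∀ e e' → χ G e ≡ a → χ G e' ≡ a → SameCycle G e e')

Carries : (G : LDigraph) → Fin (n G) → ℕ → Set
Carries G x a = ∃ λ e → SameCycle G x e × χ G e ≡ a

OnlyOnSeg : (G : LDigraph) → Fin (n G) → Fin (n G) → ℕ → Set
OnlyOnSeg G v w a = (∃ λ e → Seg G v w e × χ G e ≡ a) ×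
                    (∀ e → Seg G w v e → χ G e ≢ a)

Separates : (G : LDigraph) → Fin (n G) → Fin (n G) → ℕ → ℕ → Set
Separates G v w a b = (OnlyOnSeg G v w a × OnlyOnSeg G w v b) ⊎
                      (OnlyOnSeg G w v a × OnlyOnSeg G v w b)

ImageIs : ∀ {m k} → (Fin m → Fin k) → (Fin k → Set) → Set
ImageIs ι K = (∀ x y → ι x ≡ ι y → x ≡ y) ×
              (∀ y → K y → ∃ λ x → ι x ≡ y) ×
              (∀ x → K (ι x))

Embeds : (H G : LDigraph) → (Fin (n G) → Set) → Set
Embeds H G K = ∃ λ (ι : Fin (n H) → Fin (n G)) → ImageIs ι K ×
               (∀ x → σ G (ι x) ≡ ι (σ H x)) × (∀ x → χ G (ι x) ≡ χ H x)

-- equivalence of (G, g) and (H, h): isomorphic as labelled digraphs up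
-- to a bijective relabelling (ρ injective on the labels used by G), and
-- equal counters
Equiv : LDigraph → ℕ → LDigraph → ℕ → Set
Equiv G g H h = (g ≡ h) ×
  (∃ λ (φ : Fin (n G) → Fin (n H)) → ImageIs φ (λ _ → ⊤) ×
     (∀ x → σ H (φ x) ≡ φ (σ G x)) ×
     (∃ λ (ρ : ℕ → ℕ) →
        (∀ x y → ρ (χ G x) ≡ ρ (χ G y) → χ G x ≡ χ G y) ×
        (∀ x → χ H (φ x) ≡ ρ (χ G x))))

-- H arises from G by contracting the edge with tail u (u → σ u): the
-- vertices u and σ u are merged (the merged vertex keeps the in-edge of
-- u and the out-edge of σ u), the edge is deleted; if it is a loop the
-- then isolated vertex u is deleted.  ι identifies V(H) with V(G) - u.
Contr : LDigraph → LDigraph → Set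
Contr G H = ∃ λ (u : Fin (n G)) → ∃ λ (ι : Fin (n H) → Fin (n G)) →
  ImageIs ι (λ y → y ≢ u) ×
  (∀ x → σ G (ι x) ≢ u → σ G (ι x) ≡ ι (σ H x)) ×
  (∀ x → σ G (ι x) ≡ u → σ G u ≡ ι (σ H x)) ×
  (∀ x → χ H x ≡ χ G (ι x))

Reduction : GameState → LDigraph → ℕ → Set
Reduction S H h = h ≤ g S × Star Contr (graph S) H

-- restricted Cutter may not produce a state equivalent to a reduction of
-- an earlier game state (history includes the current state)
Forbidden : List GameState → GameState → Set
Forbidden hist S' = ∃ λ T → T ∈ hist × ∃ λ H → ∃ λ h →
  Reduction T H h × Equiv (graph S') (g S') H h

-- Splitting v and w and adding f = w₂→v₁, f' = v₂→w₁ with new label c.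
-- Vertex set Fin (2 + n): zero = v₂, suc zero = w₂, suc (suc x) = x
-- (with v ↦ v₁, w ↦ w₁).
split : (G : LDigraph) → Fin (n G) → Fin (n G) → ℕ → LDigraph
split G v w c = record { n = suc (suc (n G)) ; σ = s ; χ = l }
  where
  s : Fin (suc (suc (n G))) → Fin (suc (suc (n G)))
  s zero = suc (suc w)
  s (suc zero) = suc (suc v)
  s (suc (suc x)) with σ G x ≟ v
  ... | yes _ = zero
  ... | no _ with σ G x ≟ w
  ... | yes _ = suc zero
  ... | no _ = suc (suc (σ G x))
  l : Fin (suc (suc (n G))) → ℕ
  l zero = c
  l (suc zero) = c
  l (suc (suc x)) = χ G x

Fresh : LDigraph → ℕ → Set
Fresh G c = ∀ x → χ G x ≢ c

-- moves for v, w on the same cycle C (restricted Cutter versions: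
-- D̄ = D_k \ C, ḡ = g_k)
-- (a): D̄ ∪ Ĉ₁ ∪ Ĉ₂, counter g − 1 (needs g ≥ 1)
MoveA : (S : GameState) → Fin (n (graph S)) → Fin (n (graph S)) → GameState → Set
MoveA S v w S' = ∃ λ c → Fresh (graph S) c × 1 ≤ g S × g S' ≡ g S ∸ 1 ×
  Embeds (graph S') (split (graph S) v w c) (λ _ → ⊤)

-- (b): D̄ ∪ Ĉ₁, i.e. delete Ĉ₂ = the cycle through w₁
MoveB : (S : GameState) → Fin (n (graph S)) → Fin (n (graph S)) → GameState → Set
MoveB S v w S' = ∃ λ c → Fresh (graph S) c × g S' ≡ g S ×
  Embeds (graph S') (split (graph S) v w c)
    (λ y → ¬ SameCycle (split (graph S) v w c) (suc (suc w)) y)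

-- (c): D̄ ∪ Ĉ₂, i.e. delete Ĉ₁ = the cycle through v₁
MoveC : (S : GameState) → Fin (n (graph S)) → Fin (n (graph S)) → GameState → Set
MoveC S v w S' = ∃ λ c → Fresh (graph S) c × g S' ≡ g S ×
  Embeds (graph S') (split (graph S) v w c)
    (λ y → ¬ SameCycle (split (graph S) v w c) (suc (suc v)) y)

RMove : (S : GameState) → Fin (n (graph S)) → Fin (n (graph S)) → GameState → Set
RMove S v w S' = MoveA S v w S' ⊎ MoveB S v w S' ⊎ MoveC S v w S'

Legal : List GameState → (GameState → Set) → GameState → Set
Legal hist M S' = M S' × ¬ Forbidden hist S'

-- Suppose restricted Cutter answers with move (b): the cycle Ĉ₂, made of the segment of C from w
-- to v closed up by the new edge v₂ → w₁, is discarded, and Ĉ₁, the segment from v to w closed up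
-- by the new edge w₂ → v₁, is kept.  One of the separated labels, ℓ, occurs on the segment from w
-- to v and nowhere else in D.  Contracting every edge of that segment except one ℓ-edge t turns C
-- into a copy of Ĉ₁ in which t plays the role of w₂ → v₁, leaving the rest of D untouched.  As ℓ
-- has vanished from the rest of the graph, renaming the new label to ℓ is a bijective relabelling,
-- so the outcome of (b) is equivalent to a reduction of the current state.  Move (c) is move (b)
-- for the pair (w, v), up to exchanging v₂ and w₂, and is excluded by the other separated label.

module Submission where

open import Defs
open import Data.Nat using (ℕ; zero; suc; _+_; _*_; _∸_; _≤_; _<_; z≤n; s≤s; _<?_; _≟_)
open import Data.Nat.Properties
  using (≤-refl; ≤-reflexive; ≤-trans; <⇒≤; ≤-<-trans; <-≤-trans; <-cmp; ≮⇒≥; m≤n⇒m<n∨m≡n; n<1+n;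
         m≤n+m; m∸n≤m; m∸n+n≡m; m+[n∸m]≡n; m<n⇒0<n∸m; ∸-monoʳ-<; +-cancelʳ-<; +-monoˡ-<;
         +-suc; +-comm; *-comm; anyUpTo?)
open import Data.Fin using (Fin; zero; suc; toℕ; punchIn; punchOut) renaming (_≟_ to _≟ᶠ_)
open import Data.Fin.Properties using (pigeonhole; punchIn-injective; punchInᵢ≢i; punchIn-punchOut; any?)
open import Data.Product using (∃; _×_; _,_; proj₁; proj₂)
open import Data.Sum using (_⊎_; inj₁; inj₂; [_,_])
open import Data.Unit using (⊤; tt)
open import Data.Empty using (⊥-elim)
open import Data.List using (List)
open import Data.List.Membership.Propositional using (_∈_)
open import Function using (_∘_)
open import Function.Definitions using (Injective)
open import Relation.Nullary using (¬_; yes; no; Dec)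
open import Relation.Nullary.Decidable using (_×-dec_; ¬?)
open import Relation.Unary using (Decidable)
open import Relation.Binary.PropositionalEquality
  using (_≡_; _≢_; refl; sym; trans; cong; subst; subst₂; module ≡-Reasoning)
open import Relation.Binary using (tri<; tri≈; tri>)
open import Relation.Binary.Construct.Closure.ReflexiveTransitive using (Star; ε; _◅_; _◅◅_)

-- Iterating a map on a finite set

module _ {m : ℕ} (f : Fin m → Fin m) where

  iter-+ : ∀ i j x → iter f (i + j) x ≡ iter f i (iter f j x)
  iter-+ zero    j x = refl
  iter-+ (suc i) j x = cong f (iter-+ i j x)

  iter-suc : ∀ k x → iter f (suc k) x ≡ iter f k (f x)
  iter-suc zero    x = refl
  iter-suc (suc k) x = cong f (iter-suc k x)

  iter-*-period : ∀ {p x} → iter f p x ≡ x → ∀ k → iter f (k * p) x ≡ x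
  iter-*-period         fp zero    = refl
  iter-*-period {p} {x} fp (suc k) =
    trans (iter-+ p (k * p) x) (trans (cong (iter f p) (iter-*-period fp k)) fp)

  record FirstHit (x y : Fin m) : Set where
    field
      steps  : ℕ
      hits   : iter f steps x ≡ y
      misses : ∀ j → j < steps → iter f j x ≢ y

  firstHit : ∀ {x y} k → iter f k x ≡ y → FirstHit x y
  firstHit zero eq = record { steps = 0 ; hits = eq ; misses = λ _ () }
  firstHit {x} {y} (suc k) eq with x ≟ᶠ y
  ... | yes x≡y = record { steps = 0 ; hits = x≡y ; misses = λ _ () }
  ... | no  x≢y =
    record { steps = suc steps ; hits = trans (iter-suc steps x) hits ; misses = misses′ }
    where
    open FirstHit (firstHit k (trans (sym (iter-suc k x)) eq))
    misses′ : ∀ j → j < suc steps → iter f j x ≢ y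
    misses′ zero    _          = x≢y
    misses′ (suc j) (s≤s j<s) = misses j j<s ∘ trans (sym (iter-suc j x))

  Before : ∀ {x y} → FirstHit x y → Fin m → Set
  Before {x} h e = ∃ λ k → k < FirstHit.steps h × iter f k x ≡ e

  module _ {x y : Fin m} (h : FirstHit x y) where
    open FirstHit h

    steps>0 : x ≢ y → 0 < steps
    steps>0 x≢y with steps | hits
    ... | zero  | x≡y = ⊥-elim (x≢y x≡y)
    ... | suc _ | _   = s≤s z≤n

    Before-step : ∀ {e} → Before h e → Before h (f e) ⊎ f e ≡ y
    Before-step (k , k<s , refl) with m≤n⇒m<n∨m≡n k<s
    ... | inj₁ sk<s = inj₁ (suc k , sk<s , refl)
    ... | inj₂ sk≡s = inj₂ (trans (cong (λ i → iter f i x) sk≡s) hits)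

    Before⇒Seg : ∀ {e} → Before h e → ∃ λ k → iter f k x ≡ e × (∀ j → j ≤ k → iter f j x ≢ y)
    Before⇒Seg (k , k<s , eq) = k , eq , λ j j≤k → misses j (≤-<-trans j≤k k<s)

    Seg⇒Before : ∀ {e} → (∃ λ k → iter f k x ≡ e × (∀ j → j ≤ k → iter f j x ≢ y)) → Before h e
    Seg⇒Before (k , eq , avoids) with k <? steps
    ... | yes k<s = k , k<s , eq
    ... | no  k≮s = ⊥-elim (avoids steps (≮⇒≥ k≮s) hits)

module _ {m : ℕ} {f : Fin m → Fin m} (f-inj : Injective _≡_ _≡_ f) where

  iter-injective : ∀ k → Injective _≡_ _≡_ (iter f k)
  iter-injective zero    eq = eq
  iter-injective (suc k) eq = iter-injective k (f-inj eq)

  iter-period : ∀ x → ∃ λ p → iter f (suc p) x ≡ x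
  iter-period x with pigeonhole (n<1+n m) (λ i → iter f (toℕ i) x)
  ... | i , j , i<j , eq = toℕ j ∸ suc (toℕ i) , iter-injective (toℕ i) (begin
    iter f (toℕ i) (iter f (suc d) x)  ≡⟨ iter-+ f (toℕ i) (suc d) x ⟨
    iter f (toℕ i + suc d) x           ≡⟨ cong (λ k → iter f k x) (trans (+-suc (toℕ i) d) (m+[n∸m]≡n i<j)) ⟩
    iter f (toℕ j) x                   ≡⟨ eq ⟨
    iter f (toℕ i) x                   ∎)
    where
    open ≡-Reasoning
    d = toℕ j ∸ suc (toℕ i)

  orbit-sym : ∀ {x y} → (∃ λ k → iter f k x ≡ y) → ∃ λ k → iter f k y ≡ x
  orbit-sym {x} (k , refl) with iter-period x
  ... | p , period = p * k , (begin
    iter f (p * k) (iter f k x)  ≡⟨ iter-+ f (p * k) k x ⟨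
    iter f (p * k + k) x         ≡⟨ cong (λ i → iter f i x) (trans (+-comm (p * k) k) (*-comm (suc p) k)) ⟩
    iter f (k * suc p) x         ≡⟨ iter-*-period f period k ⟩
    x                            ∎)
    where open ≡-Reasoning

  module _ {x y : Fin m} (h : FirstHit f x y) where
    open FirstHit h

    no-early-return : ∀ d → 0 < d → d ≤ steps → iter f d x ≢ x
    no-early-return d 0<d d≤s returns = misses (steps ∸ d) (∸-monoʳ-< 0<d d≤s) (begin
      iter f (steps ∸ d) x                ≡⟨ cong (iter f (steps ∸ d)) returns ⟨
      iter f (steps ∸ d) (iter f d x)     ≡⟨ iter-+ f (steps ∸ d) d x ⟨
      iter f (steps ∸ d + d) x            ≡⟨ cong (λ i → iter f i x) (m∸n+n≡m d≤s) ⟩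
      iter f steps x                      ≡⟨ hits ⟩
      y                                   ∎)
      where open ≡-Reasoning

    Before-distinct : ∀ {i j} → i < j → j < steps → iter f i x ≢ iter f j x
    Before-distinct {i} {j} i<j j<s eq =
      no-early-return (j ∸ i) (m<n⇒0<n∸m i<j) (≤-trans (m∸n≤m j i) (<⇒≤ j<s))
        (sym (iter-injective i (begin
          iter f i x                    ≡⟨ eq ⟩
          iter f j x                    ≡⟨ cong (λ k → iter f k x) (m+[n∸m]≡n (<⇒≤ i<j)) ⟨
          iter f (i + (j ∸ i)) x        ≡⟨ iter-+ f i (j ∸ i) x ⟩
          iter f i (iter f (j ∸ i) x)   ∎)))
      where open ≡-Reasoning

σ-injective : ∀ {G} → CycleDigraph G → Injective _≡_ _≡_ (σ G)
σ-injective cd {x} {y} eq = trans (sym (σ⁻¹σ x)) (trans (cong σ⁻¹ eq) (σ⁻¹σ y))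
  where open CycleDigraph cd

Seg⇒≢ : ∀ G {x y e} → Seg G x y e → x ≢ y
Seg⇒≢ _ (_ , _ , avoids) = avoids 0 z≤n

-- Contracting a decidable set of vertices

digraph : (m : ℕ) → (Fin m → Fin m) → (Fin m → ℕ) → LDigraph
digraph m s l = record { n = m ; σ = s ; χ = l }

module Bypass {m : ℕ} {s : Fin (suc m) → Fin (suc m)} (s-inj : Injective _≡_ _≡_ s) (u : Fin (suc m))
  where

  no-loop : ∀ x → s (punchIn u x) ≡ u → s u ≢ u
  no-loop x sx≡u su≡u = punchInᵢ≢i u x (s-inj (trans sx≡u (sym su≡u)))

  bypass : Fin m → Fin m
  bypass x with s (punchIn u x) ≟ᶠ u
  ... | no  sx≢u = punchOut (sx≢u ∘ sym)
  ... | yes sx≡u = punchOut (no-loop x sx≡u ∘ sym)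

  bypass-≢ : ∀ x → s (punchIn u x) ≢ u → punchIn u (bypass x) ≡ s (punchIn u x)
  bypass-≢ x sx≢u with s (punchIn u x) ≟ᶠ u
  ... | no  _    = punchIn-punchOut _
  ... | yes sx≡u = ⊥-elim (sx≢u sx≡u)

  bypass-≡ : ∀ x → s (punchIn u x) ≡ u → punchIn u (bypass x) ≡ s u
  bypass-≡ x sx≡u with s (punchIn u x) ≟ᶠ u
  ... | no  sx≢u = ⊥-elim (sx≢u sx≡u)
  ... | yes _    = punchIn-punchOut _

  bypass-injective : Injective _≡_ _≡_ bypass
  bypass-injective {x} {y} eq = by-cases (s (punchIn u x) ≟ᶠ u) (s (punchIn u y) ≟ᶠ u)
    where
    by-cases : Dec (s (punchIn u x) ≡ u) → Dec (s (punchIn u y) ≡ u) → x ≡ y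
    by-cases (yes sx≡u) (yes sy≡u) = punchIn-injective u x y (s-inj (trans sx≡u (sym sy≡u)))
    by-cases (yes sx≡u) (no  sy≢u) = ⊥-elim (punchInᵢ≢i u y (sym (s-inj
      (trans (sym (bypass-≡ x sx≡u)) (trans (cong (punchIn u) eq) (bypass-≢ y sy≢u))))))
    by-cases (no  sx≢u) (yes sy≡u) = ⊥-elim (punchInᵢ≢i u x (sym (s-inj
      (trans (sym (bypass-≡ y sy≡u)) (trans (cong (punchIn u) (sym eq)) (bypass-≢ x sx≢u))))))
    by-cases (no  sx≢u) (no  sy≢u) = punchIn-injective u x y (s-inj
      (trans (sym (bypass-≢ x sx≢u)) (trans (cong (punchIn u) eq) (bypass-≢ y sy≢u))))

  bypass-Contr : ∀ l → Contr (digraph (suc m) s l) (digraph m bypass (l ∘ punchIn u))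
  bypass-Contr l = u , punchIn u ,
    (punchIn-injective u , (λ y y≢u → punchOut (y≢u ∘ sym) , punchIn-punchOut _) , punchInᵢ≢i u) ,
    (λ x sx≢u → sym (bypass-≢ x sx≢u)) , (λ x sx≡u → sym (bypass-≡ x sx≡u)) , (λ _ → refl)

module ContractSet (G : LDigraph) (σ-inj : Injective _≡_ _≡_ (σ G))
                   {Del : Fin (n G) → Set} (Del? : Decidable Del) where

  _⇝_ : Fin (n G) → Fin (n G) → Set
  a ⇝ b = ∃ λ k → iter (σ G) (suc k) a ≡ b × (∀ j → j < k → Del (iter (σ G) (suc j) a))

  ⇝-trans : ∀ {a b c} → a ⇝ b → Del b → b ⇝ c → a ⇝ c
  ⇝-trans {a} {b} (k , refl , dels) del (k′ , refl , dels′) =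
    k′ + suc k , iter-+ (σ G) (suc k′) (suc k) a , dels″
    where
    dels″ : ∀ j → j < k′ + suc k → Del (iter (σ G) (suc j) a)
    dels″ j j<k″ with <-cmp j k
    ... | tri< j<k _ _  = dels j j<k
    ... | tri≈ _ refl _ = del
    ... | tri> _ _ k<j  =
      subst Del (sym eq) (dels′ j′ (+-cancelʳ-< (suc k) j′ k′ (subst (_< k′ + suc k) (sym j≡) j<k″)))
      where
      j′ = j ∸ suc k
      j≡ : j′ + suc k ≡ j
      j≡ = m∸n+n≡m k<j
      eq : iter (σ G) (suc j) a ≡ iter (σ G) (suc j′) (iter (σ G) (suc k) a)
      eq = trans (cong (λ i → iter (σ G) (suc i) a) (sym j≡)) (iter-+ (σ G) (suc j′) (suc k) a)

  ⇝-functional : ∀ {a b b′} → a ⇝ b → a ⇝ b′ → ¬ Del b → ¬ Del b′ → b ≡ b′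
  ⇝-functional (k , refl , dels) (k′ , refl , dels′) kept kept′ with <-cmp k k′
  ... | tri< k<k′ _ _ = ⊥-elim (kept (dels′ k k<k′))
  ... | tri≈ _ refl _ = refl
  ... | tri> _ _ k′<k = ⊥-elim (kept′ (dels k′ k′<k))

  record Stage (m : ℕ) : Set where
    field
      σ′           : Fin m → Fin m
      χ′           : Fin m → ℕ
      ι            : Fin m → Fin (n G)
      reached      : Star Contr G (digraph m σ′ χ′)
      ι-injective  : ∀ x y → ι x ≡ ι y → x ≡ y
      ι-covers     : ∀ y → ¬ Del y → ∃ λ x → ι x ≡ y
      χ′-ι         : ∀ x → χ′ x ≡ χ G (ι x)
      σ′-injective : Injective _≡_ _≡_ σ′
      ι-σ′         : ∀ x → ι x ⇝ ι (σ′ x)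

  initial : Stage (n G)
  initial = record
    { σ′ = σ G ; χ′ = χ G ; ι = λ x → x ; reached = ε
    ; ι-injective = λ _ _ eq → eq ; ι-covers = λ y _ → y , refl ; χ′-ι = λ _ → refl
    ; σ′-injective = σ-inj ; ι-σ′ = λ _ → 0 , refl , λ _ () }

  contract : ∀ {m} (st : Stage (suc m)) u → Del (Stage.ι st u) → Stage m
  contract st u del = record
    { σ′ = bypass ; χ′ = χ′ ∘ punchIn u ; ι = ι ∘ punchIn u
    ; reached = reached ◅◅ (bypass-Contr χ′ ◅ ε)
    ; ι-injective = λ x y → punchIn-injective u x y ∘ ι-injective _ _
    ; ι-covers = covers ; χ′-ι = χ′-ι ∘ punchIn u
    ; σ′-injective = bypass-injective ; ι-σ′ = λ x → skips x (σ′ (punchIn u x) ≟ᶠ u) }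
    where
    open Stage st
    open Bypass σ′-injective u

    covers : ∀ y → ¬ Del y → ∃ λ x → ι (punchIn u x) ≡ y
    covers y kept with ι-covers y kept
    ... | x , refl = punchOut (λ u≡x → kept (subst (Del ∘ ι) u≡x del)) , cong ι (punchIn-punchOut _)

    skips : ∀ x → Dec (σ′ (punchIn u x) ≡ u) → ι (punchIn u x) ⇝ ι (punchIn u (bypass x))
    skips x (no sx≢u) rewrite bypass-≢ x sx≢u = ι-σ′ (punchIn u x)
    skips x (yes sx≡u) rewrite bypass-≡ x sx≡u =
      ⇝-trans (subst (λ z → ι (punchIn u x) ⇝ ι z) sx≡u (ι-σ′ (punchIn u x))) del (ι-σ′ u)

  Complete : ∀ {m} → Stage m → Set
  Complete st = ∀ x → ¬ Del (Stage.ι st x)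

  contractAll : ∀ {m} → Stage m → ∃ λ k → ∃ λ (st : Stage k) → Complete st
  contractAll {zero}  st = zero , st , λ ()
  contractAll {suc m} st with any? (λ x → Del? (Stage.ι st x))
  ... | yes (u , del) = contractAll (contract st u del)
  ... | no  none      = suc m , st , λ x del → none (x , del)

  module Contracted {k} (st : Stage k) (complete : Complete st) where
    open Stage st

    H : LDigraph
    H = digraph k σ′ χ′

    record SkipMap (A : LDigraph) (K : Fin (n A) → Set) : Set where
      field
        ψ           : Fin (n A) → Fin (n G)
        ψ-kept      : ∀ z → K z → ¬ Del (ψ z)
        ψ-injective : ∀ z z′ → K z → K z′ → ψ z ≡ ψ z′ → z ≡ z′
        ψ-onto      : ∀ y → ¬ Del y → ∃ λ z → K z × ψ z ≡ y
        ψ-σ         : ∀ z → K z → K (σ A z) → ψ z ⇝ ψ (σ A z)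
        ρ           : ℕ → ℕ
        ρ-injective : ∀ z z′ → K z → K z′ → ρ (χ A z) ≡ ρ (χ A z′) → χ A z ≡ χ A z′
        χ-ψ         : ∀ z → K z → χ G (ψ z) ≡ ρ (χ A z)

    SkipMap⇒Equiv : ∀ {A B K g h} → Embeds B A K → SkipMap A K → g ≡ h → Equiv B g H h
    SkipMap⇒Equiv {A} {B} {K} (κ , (κ-injective , κ-onto , κ-K) , σ-κ , χ-κ) sm g≡h =
      g≡h , φ , (φ-injective , φ-onto , λ _ → tt) , σ-φ , ρ , ρ-injective′ , χ-φ
      where
      open SkipMap sm

      φ : Fin (n B) → Fin k
      φ x = proj₁ (ι-covers _ (ψ-kept _ (κ-K x)))

      ι-φ : ∀ x → ι (φ x) ≡ ψ (κ x)
      ι-φ x = proj₂ (ι-covers _ (ψ-kept _ (κ-K x)))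

      φ-injective : ∀ x x′ → φ x ≡ φ x′ → x ≡ x′
      φ-injective x x′ eq = κ-injective x x′ (ψ-injective _ _ (κ-K x) (κ-K x′)
        (trans (sym (ι-φ x)) (trans (cong ι eq) (ι-φ x′))))

      φ-onto : ∀ y → ⊤ → ∃ λ x → φ x ≡ y
      φ-onto y _ with ψ-onto (ι y) (complete y)
      ... | z , Kz , ψz≡ιy with κ-onto z Kz
      ...   | x , refl = x , ι-injective _ _ (trans (ι-φ x) ψz≡ιy)

      σ-φ : ∀ x → σ′ (φ x) ≡ φ (σ B x)
      σ-φ x = ι-injective _ _ (⇝-functional (ι-σ′ (φ x)) step (complete _) (complete _))
        where
        step : ι (φ x) ⇝ ι (φ (σ B x))
        step = subst₂ _⇝_ (sym (ι-φ x)) (trans (cong ψ (σ-κ x)) (sym (ι-φ (σ B x))))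
                 (ψ-σ (κ x) (κ-K x) (subst K (sym (σ-κ x)) (κ-K (σ B x))))

      ρ-injective′ : ∀ x x′ → ρ (χ B x) ≡ ρ (χ B x′) → χ B x ≡ χ B x′
      ρ-injective′ x x′ eq = subst₂ _≡_ (χ-κ x) (χ-κ x′) (ρ-injective _ _ (κ-K x) (κ-K x′)
        (subst₂ (λ p q → ρ p ≡ ρ q) (sym (χ-κ x)) (sym (χ-κ x′)) eq))

      χ-φ : ∀ x → χ′ (φ x) ≡ ρ (χ B x)
      χ-φ x = begin
        χ′ (φ x)          ≡⟨ χ′-ι (φ x) ⟩
        χ G (ι (φ x))     ≡⟨ cong (χ G) (ι-φ x) ⟩
        χ G (ψ (κ x))     ≡⟨ χ-ψ (κ x) (κ-K x) ⟩
        ρ (χ A (κ x))     ≡⟨ cong ρ (χ-κ x) ⟩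
        ρ (χ B x)         ∎
        where open ≡-Reasoning

-- Vertices of split G v w c; old v and old w are v₁ and w₁.
pattern v₂    = zero
pattern w₂    = suc zero
pattern old x = suc (suc x)

module Split (G : LDigraph) (v w : Fin (n G)) (c : ℕ) where

  split-σ-v : ∀ x → σ G x ≡ v → σ (split G v w c) (old x) ≡ v₂
  split-σ-v x σx≡v with σ G x ≟ᶠ v
  ... | yes _    = refl
  ... | no σx≢v = ⊥-elim (σx≢v σx≡v)

  split-σ-w : ∀ x → σ G x ≢ v → σ G x ≡ w → σ (split G v w c) (old x) ≡ w₂
  split-σ-w x σx≢v σx≡w with σ G x ≟ᶠ v
  ... | yes σx≡v = ⊥-elim (σx≢v σx≡v)
  ... | no _ with σ G x ≟ᶠ w
  ...   | yes _    = refl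
  ...   | no σx≢w = ⊥-elim (σx≢w σx≡w)

  split-σ-old : ∀ x → σ G x ≢ v → σ G x ≢ w → σ (split G v w c) (old x) ≡ old (σ G x)
  split-σ-old x σx≢v σx≢w with σ G x ≟ᶠ v
  ... | yes σx≡v = ⊥-elim (σx≢v σx≡v)
  ... | no _ with σ G x ≟ᶠ w
  ...   | yes σx≡w = ⊥-elim (σx≢w σx≡w)
  ...   | no _     = refl

swap₂ : ∀ {m} → Fin (suc (suc m)) → Fin (suc (suc m))
swap₂ v₂      = w₂
swap₂ w₂      = v₂
swap₂ (old x) = old x

swap₂-involutive : ∀ {m} (z : Fin (suc (suc m))) → swap₂ (swap₂ z) ≡ z
swap₂-involutive v₂      = refl
swap₂-involutive w₂      = refl
swap₂-involutive (old x) = refl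

module _ (G : LDigraph) {v w : Fin (n G)} (v≢w : v ≢ w) (c : ℕ) where
  private
    module VW = Split G v w c
    module WV = Split G w v c

  split-swap-σ : ∀ z → σ (split G w v c) (swap₂ z) ≡ swap₂ (σ (split G v w c) z)
  split-swap-σ v₂      = refl
  split-swap-σ w₂      = refl
  split-swap-σ (old x) = by-cases (σ G x ≟ᶠ v) (σ G x ≟ᶠ w)
    where
    by-cases : Dec (σ G x ≡ v) → Dec (σ G x ≡ w) →
               σ (split G w v c) (old x) ≡ swap₂ (σ (split G v w c) (old x))
    by-cases (yes σx≡v) _ = trans (WV.split-σ-w x (v≢w ∘ trans (sym σx≡v)) σx≡v)
                                  (cong swap₂ (sym (VW.split-σ-v x σx≡v)))
    by-cases (no σx≢v) (yes σx≡w) = trans (WV.split-σ-v x σx≡w)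
                                          (cong swap₂ (sym (VW.split-σ-w x σx≢v σx≡w)))
    by-cases (no σx≢v) (no σx≢w) = trans (WV.split-σ-old x σx≢w σx≢v)
                                         (cong swap₂ (sym (VW.split-σ-old x σx≢v σx≢w)))

  split-swap-χ : ∀ z → χ (split G w v c) (swap₂ z) ≡ χ (split G v w c) z
  split-swap-χ v₂      = refl
  split-swap-χ w₂      = refl
  split-swap-χ (old x) = refl

module _ {A B : LDigraph} {τ : Fin (n A) → Fin (n B)} {τ⁻ : Fin (n B) → Fin (n A)}
         (τ⁻-τ : ∀ z → τ⁻ (τ z) ≡ z) (τ-τ⁻ : ∀ y → τ (τ⁻ y) ≡ y)
         (σ-τ : ∀ z → σ B (τ z) ≡ τ (σ A z)) (χ-τ : ∀ z → χ B (τ z) ≡ χ A z) where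

  iter-τ : ∀ k z → iter (σ B) k (τ z) ≡ τ (iter (σ A) k z)
  iter-τ zero    z = refl
  iter-τ (suc k) z = trans (cong (σ B) (iter-τ k z)) (σ-τ _)

  SameCycle-τ : ∀ {z y} → SameCycle A z y → SameCycle B (τ z) (τ y)
  SameCycle-τ {z} (k , refl) = k , iter-τ k z

  SameCycle-τ⁻ : ∀ {z y} → SameCycle B (τ z) y → SameCycle A z (τ⁻ y)
  SameCycle-τ⁻ {z} (k , refl) = k , trans (sym (τ⁻-τ _)) (cong τ⁻ (sym (iter-τ k z)))

  Embeds-τ : ∀ {H} z → Embeds H A (λ y → ¬ SameCycle A z y) →
                       Embeds H B (λ y → ¬ SameCycle B (τ z) y)
  Embeds-τ z (κ , (κ-injective , κ-onto , κ-K) , σ-κ , χ-κ) =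
    τ ∘ κ , (injective , onto , κ-K′) ,
    (λ x → trans (σ-τ (κ x)) (cong τ (σ-κ x))) , (λ x → trans (χ-τ (κ x)) (χ-κ x))
    where
    injective : ∀ x x′ → τ (κ x) ≡ τ (κ x′) → x ≡ x′
    injective x x′ eq = κ-injective x x′ (trans (sym (τ⁻-τ _)) (trans (cong τ⁻ eq) (τ⁻-τ _)))

    onto : ∀ y → ¬ SameCycle B (τ z) y → ∃ λ x → τ (κ x) ≡ y
    onto y Ky with κ-onto (τ⁻ y) (Ky ∘ subst (SameCycle B (τ z)) (τ-τ⁻ y) ∘ SameCycle-τ)
    ... | x , κx≡τ⁻y = x , trans (cong τ κx≡τ⁻y) (τ-τ⁻ y)

    κ-K′ : ∀ x → ¬ SameCycle B (τ z) (τ (κ x))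
    κ-K′ x = κ-K x ∘ subst (SameCycle A z) (τ⁻-τ (κ x)) ∘ SameCycle-τ⁻

MoveC⇒MoveB-swapped : ∀ S {v w} → v ≢ w → ∀ S′ → MoveC S v w S′ → MoveB S w v S′
MoveC⇒MoveB-swapped S {v} {w} v≢w S′ (c , fresh , g≡ , emb) = c , fresh , g≡ ,
  Embeds-τ {A = split (graph S) v w c} {B = split (graph S) w v c} {τ = swap₂} {τ⁻ = swap₂}
    swap₂-involutive swap₂-involutive (split-swap-σ (graph S) v≢w c) (split-swap-χ (graph S) v≢w c)
    (old v) emb

relabel : ℕ → ℕ → ℕ → ℕ
relabel c ℓ x with x ≟ c
... | yes _ = ℓ
... | no  _ = x

relabel-≡ : ∀ c ℓ → relabel c ℓ c ≡ ℓ
relabel-≡ c ℓ with c ≟ c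
... | yes _   = refl
... | no  c≢c = ⊥-elim (c≢c refl)

relabel-≢ : ∀ c ℓ {x} → x ≢ c → relabel c ℓ x ≡ x
relabel-≢ c ℓ {x} x≢c with x ≟ c
... | yes x≡c = ⊥-elim (x≢c x≡c)
... | no  _   = refl

relabel-injective : ∀ c ℓ {x y} → x ≡ c ⊎ x ≢ ℓ → y ≡ c ⊎ y ≢ ℓ →
                    relabel c ℓ x ≡ relabel c ℓ y → x ≡ y
relabel-injective c ℓ {x} {y} hx hy eq with x ≟ c | y ≟ c
... | yes x≡c | yes y≡c = trans x≡c (sym y≡c)
... | yes _   | no  y≢c = ⊥-elim ([ y≢c , (λ y≢ℓ → y≢ℓ (sym eq)) ] hy)
... | no  x≢c | yes _   = ⊥-elim ([ x≢c , (λ x≢ℓ → x≢ℓ eq) ] hx)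
... | no  _   | no  _   = eq

-- Move (b) is equivalent to a reduction

module CollapseSegment (S : GameState) {v w : Fin (n (graph S))}
    (w→v : FirstHit (σ (graph S)) w v) (v→w : FirstHit (σ (graph S)) v w)
    {ℓ : ℕ} (ℓ-isolated : Isolated (graph S) ℓ) (ℓ-only : OnlyOnSeg (graph S) w v ℓ) where

  G : LDigraph
  G = graph S

  σ-inj : Injective _≡_ _≡_ (σ G)
  σ-inj = σ-injective (cyc S)

  open FirstHit w→v renaming (steps to L; hits to w⁺L≡v; misses to w⁺≢v)

  w⁺ : ℕ → Fin (n G)
  w⁺ k = iter (σ G) k w

  OnWV OnVW : Fin (n G) → Set
  OnWV = Before (σ G) w→v
  OnVW = Before (σ G) v→w

  t : Fin (n G)
  t = proj₁ (proj₁ ℓ-only)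

  t-seg : Seg G w v t
  t-seg = proj₁ (proj₂ (proj₁ ℓ-only))

  χ-t : χ G t ≡ ℓ
  χ-t = proj₂ (proj₂ (proj₁ ℓ-only))

  w≢v : w ≢ v
  w≢v = Seg⇒≢ G t-seg

  L>0 : 0 < L
  L>0 = steps>0 (σ G) w→v w≢v

  orbit-w : ∀ q → OnWV (w⁺ q) ⊎ OnVW (w⁺ q)
  orbit-w zero = inj₁ (0 , L>0 , refl)
  orbit-w (suc q) with orbit-w q
  ... | inj₁ on with Before-step (σ G) w→v on
  ...   | inj₁ on′ = inj₁ on′
  ...   | inj₂ ≡v  = inj₂ (0 , steps>0 (σ G) v→w (w≢v ∘ sym) , sym ≡v)
  orbit-w (suc q) | inj₂ on with Before-step (σ G) v→w on
  ...   | inj₁ on′ = inj₂ on′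
  ...   | inj₂ ≡w  = inj₁ (0 , L>0 , sym ≡w)

  t-on : OnWV t
  t-on = Seg⇒Before (σ G) w→v t-seg

  kt : ℕ
  kt = proj₁ t-on

  kt<L : kt < L
  kt<L = proj₁ (proj₂ t-on)

  w⁺kt≡t : w⁺ kt ≡ t
  w⁺kt≡t = proj₂ (proj₂ t-on)

  w⁺-t : ∀ r → w⁺ (r + kt) ≡ iter (σ G) r t
  w⁺-t r = trans (iter-+ (σ G) r kt w) (cong (iter (σ G) r) w⁺kt≡t)

  ℓ-on-WV : ∀ {y} → χ G y ≡ ℓ → OnWV y
  ℓ-on-WV {y} χy≡ℓ with proj₂ ℓ-isolated t y χ-t χy≡ℓ
  ... | r , refl with orbit-w (r + kt)
  ...   | inj₁ on = subst OnWV (w⁺-t r) on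
  ...   | inj₂ on =
    ⊥-elim (proj₂ ℓ-only _ (Before⇒Seg (σ G) v→w (subst OnVW (w⁺-t r) on)) χy≡ℓ)

  Del : Fin (n G) → Set
  Del y = OnWV y × y ≢ t

  Del? : Decidable Del
  Del? y = anyUpTo? (λ k → w⁺ k ≟ᶠ y) L ×-dec ¬? (y ≟ᶠ t)

  open ContractSet G σ-inj Del?

  along : ∀ {a} i j → σ G a ≡ w⁺ i → i ≤ j → j ≤ L → (∀ q → i ≤ q → q < j → w⁺ q ≢ t) →
          a ⇝ w⁺ j
  along {a} i j σa≡w⁺i i≤j j≤L avoids-t =
    j ∸ i , trans (shift (j ∸ i)) (cong w⁺ (m∸n+n≡m i≤j)) , deleted
    where
    shift : ∀ q → iter (σ G) (suc q) a ≡ w⁺ (q + i)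
    shift q = trans (iter-suc (σ G) q a)
                    (trans (cong (iter (σ G) q) σa≡w⁺i) (sym (iter-+ (σ G) q i w)))

    deleted : ∀ q → q < j ∸ i → Del (iter (σ G) (suc q) a)
    deleted q q<j∸i = subst Del (sym (shift q))
      ((q + i , <-≤-trans q+i<j j≤L , refl) , avoids-t (q + i) (m≤n+m i q) q+i<j)
      where
      q+i<j : q + i < j
      q+i<j = subst (q + i <_) (m∸n+n≡m i≤j) (+-monoˡ-< i q<j∸i)

  t⇝v : t ⇝ v
  t⇝v = subst (t ⇝_) w⁺L≡v (along (suc kt) L (cong (σ G) (sym w⁺kt≡t)) kt<L ≤-refl
    (λ q kt<q q<L w⁺q≡t → Before-distinct σ-inj w→v kt<q q<L (trans w⁺kt≡t (sym w⁺q≡t))))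

  pred-w⇝t : ∀ {y} → σ G y ≡ w → y ⇝ t
  pred-w⇝t σy≡w = subst (_ ⇝_) w⁺kt≡t (along 0 kt σy≡w z≤n (<⇒≤ kt<L)
    (λ q _ q<kt w⁺q≡t → Before-distinct σ-inj w→v q<kt kt<L (trans w⁺q≡t (sym w⁺kt≡t))))

  contracted : ∃ λ k → ∃ λ (st : Stage k) → Complete st
  contracted = contractAll initial

  open Contracted (proj₁ (proj₂ contracted)) (proj₂ (proj₂ contracted))

  module _ (c : ℕ) where
    open Split G v w c

    sp : LDigraph
    sp = split G v w c

    split-σ-w⁺ : ∀ j → suc j < L → σ sp (old (w⁺ j)) ≡ old (w⁺ (suc j))
    split-σ-w⁺ j sj<L = split-σ-old (w⁺ j) (w⁺≢v (suc j) sj<L)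
      (no-early-return σ-inj w→v (suc j) (s≤s z≤n) (<⇒≤ sj<L))

    split-σ-w⁺-last : ∀ j → suc j ≡ L → σ sp (old (w⁺ j)) ≡ v₂
    split-σ-w⁺-last j sj≡L = split-σ-v (w⁺ j) (trans (cong w⁺ sj≡L) w⁺L≡v)

    w₁-orbit : ∀ k → k < L → iter (σ sp) k (old w) ≡ old (w⁺ k)
    w₁-orbit zero    _     = refl
    w₁-orbit (suc k) sk<L = trans (cong (σ sp) (w₁-orbit k (<⇒≤ sk<L))) (split-σ-w⁺ k sk<L)

    w₁-reaches-v₂ : SameCycle sp (old w) v₂
    w₁-reaches-v₂ = L , trans (cong (λ i → iter (σ sp) i (old w)) (sym sj≡L))
                          (trans (cong (σ sp) (w₁-orbit j (≤-reflexive sj≡L))) (split-σ-w⁺-last j sj≡L))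
      where
      j = L ∸ 1
      sj≡L : suc j ≡ L
      sj≡L = m+[n∸m]≡n L>0

    OnW₁Cycle : Fin (n sp) → Set
    OnW₁Cycle z = z ≡ v₂ ⊎ ∃ λ j → j < L × z ≡ old (w⁺ j)

    OnW₁Cycle-σ : ∀ {z} → OnW₁Cycle z → OnW₁Cycle (σ sp z)
    OnW₁Cycle-σ (inj₁ refl) = inj₂ (0 , L>0 , refl)
    OnW₁Cycle-σ (inj₂ (j , j<L , refl)) with m≤n⇒m<n∨m≡n j<L
    ... | inj₁ sj<L = inj₂ (suc j , sj<L , split-σ-w⁺ j sj<L)
    ... | inj₂ sj≡L = inj₁ (split-σ-w⁺-last j sj≡L)

    w₁-cycle : ∀ {z} → SameCycle sp (old w) z → OnW₁Cycle z
    w₁-cycle (k , refl) = iterate k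
      where
      iterate : ∀ k → OnW₁Cycle (iter (σ sp) k (old w))
      iterate zero    = inj₂ (0 , L>0 , refl)
      iterate (suc k) = OnW₁Cycle-σ (iterate k)

    Kept : Fin (n sp) → Set
    Kept z = ¬ SameCycle sp (old w) z

    ¬kept-v₂ : ¬ Kept v₂
    ¬kept-v₂ kept = kept w₁-reaches-v₂

    kept-w₂ : Kept w₂
    kept-w₂ on with w₁-cycle on
    ... | inj₁ ()
    ... | inj₂ (_ , _ , ())

    kept-old : ∀ {y} → ¬ OnWV y → Kept (old y)
    kept-old ¬on on with w₁-cycle on
    ... | inj₂ (j , j<L , refl) = ¬on (j , j<L , refl)

    kept-old⁻ : ∀ {y} → Kept (old y) → ¬ OnWV y
    kept-old⁻ kept (j , j<L , refl) = kept (j , w₁-orbit j j<L)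

    ψ : Fin (n sp) → Fin (n G)
    ψ v₂      = t  -- v₂ is never kept, so this value is irrelevant
    ψ w₂      = t
    ψ (old y) = y

    ψ-injective : ∀ z z′ → Kept z → Kept z′ → ψ z ≡ ψ z′ → z ≡ z′
    ψ-injective v₂ _ kept _ _ = ⊥-elim (¬kept-v₂ kept)
    ψ-injective _ v₂ _ kept _ = ⊥-elim (¬kept-v₂ kept)
    ψ-injective w₂ w₂ _ _ _ = refl
    ψ-injective w₂ (old y) _ kept t≡y = ⊥-elim (kept-old⁻ kept (subst OnWV t≡y t-on))
    ψ-injective (old y) w₂ kept _ y≡t = ⊥-elim (kept-old⁻ kept (subst OnWV (sym y≡t) t-on))
    ψ-injective (old y) (old y′) _ _ y≡y′ = cong old y≡y′

    ψ-σ : ∀ z → Kept z → Kept (σ sp z) → ψ z ⇝ ψ (σ sp z)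
    ψ-σ v₂ kept _ = ⊥-elim (¬kept-v₂ kept)
    ψ-σ w₂ _ _ = t⇝v
    ψ-σ (old y) _ kept′ = by-cases (σ G y ≟ᶠ v) (σ G y ≟ᶠ w)
      where
      by-cases : Dec (σ G y ≡ v) → Dec (σ G y ≡ w) → y ⇝ ψ (σ sp (old y))
      by-cases (yes σy≡v) _ = ⊥-elim (¬kept-v₂ (subst Kept (split-σ-v y σy≡v) kept′))
      by-cases (no σy≢v) (yes σy≡w) =
        subst (λ z → y ⇝ ψ z) (sym (split-σ-w y σy≢v σy≡w)) (pred-w⇝t σy≡w)
      by-cases (no σy≢v) (no σy≢w) =
        subst (λ z → y ⇝ ψ z) (sym (split-σ-old y σy≢v σy≢w)) (0 , refl , λ _ ())

    kept-label : ∀ z → Kept z → χ sp z ≡ c ⊎ χ sp z ≢ ℓ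
    kept-label v₂      kept = ⊥-elim (¬kept-v₂ kept)
    kept-label w₂      _    = inj₁ refl
    kept-label (old y) kept = inj₂ (kept-old⁻ kept ∘ ℓ-on-WV)

    collapse : Fresh G c → SkipMap sp Kept
    collapse fresh = record
      { ψ           = ψ
      ; ψ-kept      = ψ-kept
      ; ψ-injective = ψ-injective
      ; ψ-onto      = ψ-onto
      ; ψ-σ         = ψ-σ
      ; ρ           = relabel c ℓ
      ; ρ-injective = λ z z′ kept kept′ →
                        relabel-injective c ℓ (kept-label z kept) (kept-label z′ kept′)
      ; χ-ψ         = χ-ψ
      }
      where
      ψ-kept : ∀ z → Kept z → ¬ Del (ψ z)
      ψ-kept v₂      kept _          = ¬kept-v₂ kept
      ψ-kept w₂      _    (_ , t≢t) = t≢t refl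
      ψ-kept (old y) kept (on , _)   = kept-old⁻ kept on

      ψ-onto : ∀ y → ¬ Del y → ∃ λ z → Kept z × ψ z ≡ y
      ψ-onto y ¬del with y ≟ᶠ t
      ... | yes y≡t = w₂ , kept-w₂ , sym y≡t
      ... | no  y≢t = old y , kept-old (λ on → ¬del (on , y≢t)) , refl

      χ-ψ : ∀ z → Kept z → χ G (ψ z) ≡ relabel c ℓ (χ sp z)
      χ-ψ v₂      kept = ⊥-elim (¬kept-v₂ kept)
      χ-ψ w₂      _    = trans χ-t (sym (relabel-≡ c ℓ))
      χ-ψ (old y) _    = sym (relabel-≢ c ℓ (fresh y))

  forbidden : ∀ {hist} → S ∈ hist → ∀ S′ → MoveB S v w S′ → Forbidden hist S′
  forbidden S∈ S′ (c , fresh , g≡ , emb) =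
    S , S∈ , H , g S , (≤-refl , Stage.reached (proj₁ (proj₂ contracted))) ,
    SkipMap⇒Equiv emb (collapse c fresh) g≡

IsolatedOnlyOn : (G : LDigraph) → Fin (n G) → Fin (n G) → Set
IsolatedOnlyOn G x y = ∃ λ ℓ → Isolated G ℓ × OnlyOnSeg G x y ℓ

IsolatedOnlyOn⇒≢ : ∀ G {x y} → IsolatedOnlyOn G x y → x ≢ y
IsolatedOnlyOn⇒≢ G (_ , _ , (_ , seg , _) , _) = Seg⇒≢ G seg

Separates⇒IsolatedOnlyOn : ∀ {G v w a b} → Isolated G a → Isolated G b → Separates G v w a b →
                           IsolatedOnlyOn G w v × IsolatedOnlyOn G v w
Separates⇒IsolatedOnlyOn {a = a} {b} a-iso b-iso (inj₁ (a-vw , b-wv)) =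
  (b , b-iso , b-wv) , (a , a-iso , a-vw)
Separates⇒IsolatedOnlyOn {a = a} {b} a-iso b-iso (inj₂ (a-wv , b-vw)) =
  (a , a-iso , a-wv) , (b , b-iso , b-vw)

MoveB-forbidden : ∀ {hist S} v w → S ∈ hist → SameCycle (graph S) v w →
                  IsolatedOnlyOn (graph S) w v → ∀ S′ → MoveB S v w S′ → Forbidden hist S′
MoveB-forbidden {S = S} v w S∈ v~w (ℓ , ℓ-isolated , ℓ-only) =
  CollapseSegment.forbidden S (firstHit (σ (graph S)) (proj₁ w~v) (proj₂ w~v))
    (firstHit (σ (graph S)) (proj₁ v~w) (proj₂ v~w)) ℓ-isolated ℓ-only S∈
  where
  w~v : SameCycle (graph S) w v
  w~v = orbit-sym (σ-injective (cyc S)) v~w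

lemma4p8 : (hist : List GameState) (S : GameState) → S ∈ hist →
    (v w : Fin (n (graph S))) → SameCycle (graph S) v w →
    (a b : ℕ) → Isolated (graph S) a → Isolated (graph S) b →
    Carries (graph S) v a → Carries (graph S) v b →
    Separates (graph S) v w a b →
    (∀ S' → ¬ Legal hist (MoveB S v w) S') ×
    (∀ S' → ¬ Legal hist (MoveC S v w) S') ×
    (∀ S' → Legal hist (RMove S v w) S' → MoveA S v w S')
lemma4p8 hist S S∈ v w v~w a b a-iso b-iso _ _ sep = ¬B , ¬C , only-A
  where
  on-wv : IsolatedOnlyOn (graph S) w v
  on-wv = proj₁ (Separates⇒IsolatedOnlyOn a-iso b-iso sep)

  on-vw : IsolatedOnlyOn (graph S) v w
  on-vw = proj₂ (Separates⇒IsolatedOnlyOn a-iso b-iso sep)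

  ¬B : ∀ S′ → ¬ Legal hist (MoveB S v w) S′
  ¬B S′ (moveB , allowed) = allowed (MoveB-forbidden v w S∈ v~w on-wv S′ moveB)

  ¬C : ∀ S′ → ¬ Legal hist (MoveC S v w) S′
  ¬C S′ (moveC , allowed) = allowed (MoveB-forbidden w v S∈ w~v on-vw S′
    (MoveC⇒MoveB-swapped S (IsolatedOnlyOn⇒≢ (graph S) on-vw) S′ moveC))
    where
    w~v : SameCycle (graph S) w v
    w~v = orbit-sym (σ-injective (cyc S)) v~w

  only-A : ∀ S′ → Legal hist (RMove S v w) S′ → MoveA S v w S′
  only-A S′ (inj₁ moveA , _)               = moveA
  only-A S′ (inj₂ (inj₁ moveB) , allowed) = ⊥-elim (¬B S′ (moveB , allowed))
  only-A S′ (inj₂ (inj₂ moveC) , allowed) = ⊥-elim (¬C S′ (moveC , allowed))
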